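{- Let $p>3$ be a prime and suppose that $x,y,z$ are nonzero pairwise coprime integers with $p\mid y$ and $x^p+y^p+z^p=0$. If $q\neq p$ is a prime such that $y\equiv 0 \pmod q$ and $x+z\not\equiv 0\pmod q$, then $q-1\equiv 0 \pmod{p^2}$. -}

module Defs where

module Submission where

-- Since p ∣ y and x ⊥ y, the two factors x + y and Φ = (x^p + y^p)/(x + y) of (−z)^p are
-- coprime (a common prime divides Φ ≡ p·x^(p−1) mod x + y), so x + y = c^p; likewise
-- z + y = e^p. Modulo q, which divides y, this gives c^p ≡ x, (−e)^p ≡ −z and x^p ≡ −z^p,
-- hence c^(p²) ≡ (−e)^(p²), while c^p ≢ (−e)^p because q ∤ x + z. The exponents k with
-- c^k ≡ (−e)^k are closed under Bézout combinations (c is a unit mod q) and contain q − 1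
-- by Fermat, so they contain gcd(p², q − 1). This gcd does not divide p, hence equals p².

module NatPrimes where

  open import Data.Nat.Base
  open import Data.Nat.Properties using (_≟_; *-identityˡ)
  open import Data.Nat.Divisibility
  open import Data.Nat.Primality
  open import Data.Nat.Primality.Factorisation using (factorise)
  open import Data.Nat.Coprimality using (Coprime; coprime-divisor)
  open import Data.Nat.ListAction using (product)
  open import Data.List.Base using ([]; _∷_)
  open import Data.List.Relation.Unary.All using (_∷_)
  open import Data.Parity.Base using (0ℙ; 1ℙ)
  open import Data.Product using (∃-syntax; _×_; _,_)
  open import Data.Sum using (_⊎_; inj₁; inj₂)
  open import Relation.Nullary using (¬_; yes; no; contradiction)
  open import Relation.Binary.PropositionalEquality

  private variable m n r s : ℕ

  prime⇒≢1 : Prime r → r ≢ 1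
  prime⇒≢1 (prime _) = nonTrivial⇒≢1

  ≢1⇒∃prime∣ : n ≢ 1 → ∃[ r ] Prime r × r ∣ n
  ≢1⇒∃prime∣ {zero} _ = 2 , prime[2] , (2 ∣0)
  ≢1⇒∃prime∣ {suc n} n≢1 with factorise (suc n)
  ... | record { factors = [] ; isFactorisation = eq } = contradiction eq n≢1
  ... | record { factors = r ∷ rs ; isFactorisation = eq ; factorsPrime = pr ∷ _ } =
    r , pr , subst (r ∣_) (sym eq) (m∣m*n (product rs))

  ¬common-prime⇒coprime : (∀ {r} → Prime r → r ∣ m → ¬ r ∣ n) → Coprime m n
  ¬common-prime⇒coprime noPrime {d} (d∣m , d∣n) with d ≟ 1
  ... | yes d≡1 = d≡1
  ... | no d≢1 with ≢1⇒∃prime∣ d≢1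
  ...   | r , pr , r∣d = contradiction (∣-trans r∣d d∣n) (noPrime pr (∣-trans r∣d d∣m))

  prime∣^⇒prime∣ : ∀ k → Prime r → r ∣ m ^ k → r ∣ m
  prime∣^⇒prime∣ zero pr r∣1 = contradiction (∣1⇒≡1 r∣1) (prime⇒≢1 pr)
  prime∣^⇒prime∣ {m = m} (suc k) pr r∣m^1+k with euclidsLemma m (m ^ k) pr r∣m^1+k
  ... | inj₁ r∣m = r∣m
  ... | inj₂ r∣m^k = prime∣^⇒prime∣ k pr r∣m^k

  prime∣prime⇒≡ : Prime r → Prime s → r ∣ s → r ≡ s
  prime∣prime⇒≡ pr ps r∣s with prime⇒irreducible ps r∣s
  ... | inj₁ r≡1 = contradiction r≡1 (prime⇒≢1 pr)
  ... | inj₂ r≡s = r≡s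

  ∣p*p⇒∣p⊎≡p*p : ∀ {p d} → Prime p → d ∣ p * p → d ∣ p ⊎ d ≡ p * p
  ∣p*p⇒∣p⊎≡p*p {p} {d} pp d∣p*p with p ∣? d
  ... | no p∤d = inj₁ (coprime-divisor d⊥p d∣p*p)
    where
    d⊥p : Coprime d p
    d⊥p = ¬common-prime⇒coprime λ pr r∣d r∣p →
      p∤d (subst (_∣ d) (prime∣prime⇒≡ pr pp r∣p) r∣d)
  ... | yes (divides e refl)
      with prime⇒irreducible pp (*-cancelʳ-∣ {e} p {{prime⇒nonZero pp}} d∣p*p)
  ...   | inj₁ refl = inj₁ (∣-reflexive (*-identityˡ p))
  ...   | inj₂ refl = inj₂ refl

  prime≢2⇒parity≡1 : ∀ {p} → Prime p → p ≢ 2 → parity p ≡ 1ℙ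
  prime≢2⇒parity≡1 {p} pp p≢2 with parity p in eq
  ... | 1ℙ = refl
  ... | 0ℙ = contradiction (sym (prime∣prime⇒≡ prime[2] pp (parity≡0⇒2∣ p eq))) p≢2
    where
    parity≡0⇒2∣ : ∀ n → parity n ≡ 0ℙ → 2 ∣ n
    parity≡0⇒2∣ zero _ = 2 ∣0
    parity≡0⇒2∣ (suc (suc n)) eq = ∣m∣n⇒∣m+n ∣-refl (parity≡0⇒2∣ n eq)

module CoprimeFactorsOfPowers where

  open import Data.Nat.Base
  open import Data.Nat.Properties
    using (*-comm; *-cancelʳ-≡; m^n≢0; m*n≡0⇒m≡0∨n≡0; m*n≡1⇒m≡1; ^-zeroˡ
          ; [m*n]*[o*p]≡[m*o]*[n*p]; *-commutativeSemigroup)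
  open import Algebra.Properties.CommutativeSemigroup *-commutativeSemigroup
    using (xy∙z≈xz∙y)
  open import Data.Nat.Divisibility
  open import Data.Nat.Primality using (Prime; prime; euclidsLemma; prime⇒nonZero)
  open import Data.Nat.Coprimality as Coprimality using (Coprime; coprime-divisor)
  open import Data.Nat.Induction using (<-rec)
  open import Data.Product using (∃-syntax; _×_; _,_)
  open import Data.Sum using (inj₁; inj₂)
  open import Relation.Nullary using (¬_)
  open import Relation.Binary.PropositionalEquality
  open NatPrimes

  ^-distribʳ-* : ∀ m n k → (m * n) ^ k ≡ m ^ k * n ^ k
  ^-distribʳ-* m n zero = refl
  ^-distribʳ-* m n (suc k) = begin
    m * n * (m * n) ^ k      ≡⟨ cong (m * n *_) (^-distribʳ-* m n k) ⟩
    m * n * (m ^ k * n ^ k)  ≡⟨ [m*n]*[o*p]≡[m*o]*[n*p] m n (m ^ k) (n ^ k) ⟩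
    m * m ^ k * (n * n ^ k)  ∎
    where open ≡-Reasoning

  coprime-∣ˡ : ∀ {a a′ b} → a′ ∣ a → Coprime a b → Coprime a′ b
  coprime-∣ˡ a′∣a a⊥b (d∣a′ , d∣b) = a⊥b (∣-trans d∣a′ a′∣a , d∣b)

  prime∤⇒coprime-^ : ∀ {r b} k → Prime r → ¬ r ∣ b → Coprime (r ^ k) b
  prime∤⇒coprime-^ k pr r∤b = ¬common-prime⇒coprime λ ps s∣rᵏ s∣b →
    r∤b (subst (_∣ _) (prime∣prime⇒≡ ps pr (prime∣^⇒prime∣ k ps s∣rᵏ)) s∣b)

  prime∣coprime-factor⇒^∣ : ∀ n {A B C r} → Prime r → Coprime A B → r ∣ A →
    A * B ≡ (C * r) ^ n → ∃[ A′ ] A ≡ A′ * r ^ n × Coprime A′ B × A′ * B ≡ C ^ n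
  prime∣coprime-factor⇒^∣ n {A} {B} {C} {r} pr A⊥B r∣A AB≡[Cr]ⁿ =
    A′ , A≡A′rⁿ , coprime-∣ˡ A′∣A A⊥B , A′B≡Cⁿ
    where
    instance
      _ = prime⇒nonZero pr
      _ = m^n≢0 r n
    r∤B : ¬ r ∣ B
    r∤B r∣B = prime⇒≢1 pr (A⊥B (r∣A , r∣B))
    rⁿ∣A : r ^ n ∣ A
    rⁿ∣A = coprime-divisor (prime∤⇒coprime-^ n pr r∤B) (begin
      r ^ n          ∣⟨ n∣m*n (C ^ n) ⟩
      C ^ n * r ^ n  ≡⟨ sym (^-distribʳ-* C r n) ⟩
      (C * r) ^ n    ≡⟨ sym AB≡[Cr]ⁿ ⟩
      A * B          ≡⟨ *-comm A B ⟩
      B * A          ∎)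
      where open ∣-Reasoning
    A′ : ℕ
    A′ = quotient rⁿ∣A
    A≡A′rⁿ : A ≡ A′ * r ^ n
    A≡A′rⁿ = m∣n⇒n≡quotient*m rⁿ∣A
    A′∣A : A′ ∣ A
    A′∣A = quotient-∣ rⁿ∣A
    A′B≡Cⁿ : A′ * B ≡ C ^ n
    A′B≡Cⁿ = *-cancelʳ-≡ (A′ * B) (C ^ n) (r ^ n) (begin
      A′ * B * r ^ n    ≡⟨ xy∙z≈xz∙y A′ B (r ^ n) ⟩
      A′ * r ^ n * B    ≡⟨ cong (_* B) (sym A≡A′rⁿ) ⟩
      A * B             ≡⟨ AB≡[Cr]ⁿ ⟩
      (C * r) ^ n       ≡⟨ ^-distribʳ-* C r n ⟩
      C ^ n * r ^ n     ∎)
      where open ≡-Reasoning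

  m∣m^n : ∀ m n .{{_ : NonZero n}} → m ∣ m ^ n
  m∣m^n m (suc n) = m∣m*n (m ^ n)

  -- Strong induction on C: for a prime r ∣ C, all of r^n sits in A or in B.
  coprime-*≡^⇒^ : ∀ n .{{_ : NonZero n}} C {A B} → Coprime A B → A * B ≡ C ^ n →
    ∃[ a ] A ≡ a ^ n
  coprime-*≡^⇒^ n = <-rec _ step
    where
    P : ℕ → Set
    P C = ∀ {A B} → Coprime A B → A * B ≡ C ^ n → ∃[ a ] A ≡ a ^ n

    0^n≡0 : ∀ n .{{_ : NonZero n}} → 0 ^ n ≡ 0
    0^n≡0 (suc n) = refl

    step : ∀ C → (∀ {C′} → C′ < C → P C′) → P C
    step 0 _ {A} A⊥B AB≡0 with m*n≡0⇒m≡0∨n≡0 A (trans AB≡0 (0^n≡0 n))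
    ... | inj₁ A≡0 = 0 , trans A≡0 (sym (0^n≡0 n))
    ... | inj₂ refl = 1 , trans (A⊥B (∣-refl , (A ∣0))) (sym (^-zeroˡ n))
    step 1 _ {A} {B} A⊥B AB≡1 =
      1 , trans (m*n≡1⇒m≡1 A B (trans AB≡1 (^-zeroˡ n))) (sym (^-zeroˡ n))
    step C@(2+ _) smaller {A} {B} A⊥B AB≡Cⁿ with ≢1⇒∃prime∣ {C} (λ ())
    ... | r , pr@(prime _) , r∣C@(divides C′ C≡C′r)
        with euclidsLemma A B pr (subst (r ∣_) (sym AB≡Cⁿ) (∣-trans r∣C (m∣m^n C n)))
    ...   | inj₁ r∣A =
      let A′ , A≡A′rⁿ , A′⊥B , A′B≡C′ⁿ = prime∣coprime-factor⇒^∣ n pr A⊥B r∣A AB≡[C′r]ⁿ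
          a , A′≡aⁿ = smaller (quotient-< r∣C) A′⊥B A′B≡C′ⁿ
      in a * r , (begin
        A              ≡⟨ A≡A′rⁿ ⟩
        A′ * r ^ n     ≡⟨ cong (_* r ^ n) A′≡aⁿ ⟩
        a ^ n * r ^ n  ≡⟨ sym (^-distribʳ-* a r n) ⟩
        (a * r) ^ n    ∎)
      where
      open ≡-Reasoning
      AB≡[C′r]ⁿ : A * B ≡ (C′ * r) ^ n
      AB≡[C′r]ⁿ = trans AB≡Cⁿ (cong (_^ n) C≡C′r)
    ...   | inj₂ r∣B =
      let _ , _ , B′⊥A , B′A≡C′ⁿ =
            prime∣coprime-factor⇒^∣ n pr (Coprimality.sym A⊥B) r∣B BA≡[C′r]ⁿ
      in smaller (quotient-< r∣C) (Coprimality.sym B′⊥A) (trans (*-comm A _) B′A≡C′ⁿ)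
      where
      BA≡[C′r]ⁿ : B * A ≡ (C′ * r) ^ n
      BA≡[C′r]ⁿ = trans (*-comm B A) (trans AB≡Cⁿ (cong (_^ n) C≡C′r))

module IntegerPowers where

  open import Data.Nat.Base as ℕ using (ℕ; zero; suc; parity)
  open import Data.Parity.Base using (1ℙ)
  open import Data.Integer.Base hiding (suc)
  open import Data.Integer.Properties using (abs-*; pos-*; neg-distribˡ-*)
  open import Data.Integer.Coprimality using (Coprime)
  open import Data.Integer.Tactic.RingSolver using (solve-∀)
  open import Data.Product using (∃-syntax; _,_)
  open import Relation.Binary.PropositionalEquality
  open CoprimeFactorsOfPowers using (coprime-*≡^⇒^)

  pos-^ : ∀ m n → (+ m) ^ n ≡ + (m ℕ.^ n)
  pos-^ m zero = refl
  pos-^ m (suc n) = trans (cong (+ m *_) (pos-^ m n)) (sym (pos-* m (m ℕ.^ n)))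

  abs-^ : ∀ i n → ∣ i ^ n ∣ ≡ ∣ i ∣ ℕ.^ n
  abs-^ i zero = refl
  abs-^ i (suc n) = trans (abs-* i (i ^ n)) (cong (∣ i ∣ ℕ.*_) (abs-^ i n))

  neg-^-odd : ∀ i n → parity n ≡ 1ℙ → (- i) ^ n ≡ - (i ^ n)
  neg-^-odd i 1 _ = sym (neg-distribˡ-* i 1ℤ)
  neg-^-odd i (suc (suc n)) odd = begin
    - i * (- i * (- i) ^ n)   ≡⟨ cong (λ t → - i * (- i * t)) (neg-^-odd i n odd) ⟩
    - i * (- i * - (i ^ n))   ≡⟨ sign-rule i (i ^ n) ⟩
    - (i * (i * i ^ n))       ∎
    where
    open ≡-Reasoning
    sign-rule : ∀ a b → - a * (- a * - b) ≡ - (a * (a * b))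
    sign-rule = solve-∀

  coprime-*≡^⇒^ℤ : ∀ n → parity n ≡ 1ℙ → ∀ C {A B} → Coprime A B → A * B ≡ C ^ n →
    ∃[ a ] A ≡ a ^ n
  coprime-*≡^⇒^ℤ zero ()
  coprime-*≡^⇒^ℤ n@(suc _) odd C {A} {B} A⊥B AB≡Cⁿ =
    let a , ∣A∣≡aⁿ = coprime-*≡^⇒^ n ∣ C ∣ A⊥B ∣A∣∣B∣≡∣C∣ⁿ in root A a ∣A∣≡aⁿ
    where
    open ≡-Reasoning
    ∣A∣∣B∣≡∣C∣ⁿ : ∣ A ∣ ℕ.* ∣ B ∣ ≡ ∣ C ∣ ℕ.^ n
    ∣A∣∣B∣≡∣C∣ⁿ = trans (sym (abs-* A B)) (trans (cong ∣_∣ AB≡Cⁿ) (abs-^ C n))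
    root : ∀ A a → ∣ A ∣ ≡ a ℕ.^ n → ∃[ b ] A ≡ b ^ n
    root (+ m) a m≡aⁿ = + a , (begin
      + m          ≡⟨ cong +_ m≡aⁿ ⟩
      + (a ℕ.^ n)  ≡⟨ sym (pos-^ a n) ⟩
      (+ a) ^ n    ∎)
    root -[1+ m ] a 1+m≡aⁿ = - + a , (begin
      - + suc m      ≡⟨ cong (λ k → - + k) 1+m≡aⁿ ⟩
      - + (a ℕ.^ n)  ≡⟨ cong -_ (sym (pos-^ a n)) ⟩
      - (+ a) ^ n    ≡⟨ sym (neg-^-odd (+ a) n odd) ⟩
      (- + a) ^ n    ∎)

module Congruence where

  open import Data.Nat.Base using (zero; suc)
  import Data.Nat.Divisibility as ℕD
  open import Data.Nat.Primality using (Prime; euclidsLemma)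
  open import Data.Integer.Base hiding (suc)
  open import Data.Integer.Properties using (abs-*; +-identityʳ)
  open import Data.Integer.Divisibility.Signed
  open import Data.Integer.Tactic.RingSolver using (solve-∀)
  open import Data.Sum using (_⊎_; inj₁; inj₂; [_,_]′)
  open import Function using (flip)
  open import Relation.Binary.Bundles using (Setoid)
  open import Relation.Nullary using (¬_; contradiction)
  open import Relation.Binary.PropositionalEquality using (_≡_; refl; sym; cong; subst)
  import Relation.Binary.Reasoning.Setoid as SetoidReasoning

  -- A record rather than a synonym for m ∣ a - b, so that a, b and m stay inferable.
  infix 4 _≡_mod_
  record _≡_mod_ (a b m : ℤ) : Set where
    constructor mk≡mod
    field ∣-difference : m ∣ a - b
  open _≡_mod_ public

  private variable a b c d m : ℤ

  ∣⇒≡0-mod : m ∣ a → a ≡ 0ℤ mod m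
  ∣⇒≡0-mod {a = a} m∣a = mk≡mod (subst (_ ∣_) (sym (+-identityʳ a)) m∣a)

  ≡0-mod⇒∣ : a ≡ 0ℤ mod m → m ∣ a
  ≡0-mod⇒∣ {a = a} (mk≡mod m∣a-0) = subst (_ ∣_) (+-identityʳ a) m∣a-0

  ≡⇒≡-mod : a ≡ b → a ≡ b mod m
  ≡⇒≡-mod {a = a} refl = mk≡mod (subst (_ ∣_) (sym (x-x≡0 a)) (divides 0ℤ refl))
    where
    x-x≡0 : ∀ x → x - x ≡ 0ℤ
    x-x≡0 = solve-∀

  ≡-mod-refl : a ≡ a mod m
  ≡-mod-refl = ≡⇒≡-mod refl

  ≡-mod-sym : a ≡ b mod m → b ≡ a mod m
  ≡-mod-sym {a = a} {b = b} (mk≡mod m∣a-b) =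
    mk≡mod (subst (_ ∣_) (negate a b) (∣m⇒∣-m m∣a-b))
    where
    negate : ∀ x y → - (x - y) ≡ y - x
    negate = solve-∀

  ≡-mod-trans : a ≡ b mod m → b ≡ c mod m → a ≡ c mod m
  ≡-mod-trans {a = a} {b = b} {c = c} (mk≡mod m∣a-b) (mk≡mod m∣b-c) =
    mk≡mod (subst (_ ∣_) (telescope a b c) (∣m∣n⇒∣m+n m∣a-b m∣b-c))
    where
    telescope : ∀ x y z → (x - y) + (y - z) ≡ x - z
    telescope = solve-∀

  ≡-mod-setoid : ℤ → Setoid _ _
  ≡-mod-setoid m = record
    { Carrier = ℤ
    ; _≈_ = λ a b → a ≡ b mod m
    ; isEquivalence = record { refl = ≡-mod-refl ; sym = ≡-mod-sym ; trans = ≡-mod-trans }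
    }

  module ≡-mod-Reasoning (m : ℤ) = SetoidReasoning (≡-mod-setoid m)

  +-cong-mod : a ≡ b mod m → c ≡ d mod m → a + c ≡ b + d mod m
  +-cong-mod {a = a} {b = b} {c = c} {d = d} (mk≡mod m∣a-b) (mk≡mod m∣c-d) =
    mk≡mod (subst (_ ∣_) (regroup a b c d) (∣m∣n⇒∣m+n m∣a-b m∣c-d))
    where
    regroup : ∀ a b c d → (a - b) + (c - d) ≡ (a + c) - (b + d)
    regroup = solve-∀

  +-congˡ-mod : ∀ a → b ≡ c mod m → a + b ≡ a + c mod m
  +-congˡ-mod a = +-cong-mod (≡-mod-refl {a = a})

  +-congʳ-mod : ∀ c → a ≡ b mod m → a + c ≡ b + c mod m
  +-congʳ-mod c a≡b = +-cong-mod a≡b (≡-mod-refl {a = c})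

  *-cong-mod : a ≡ b mod m → c ≡ d mod m → a * c ≡ b * d mod m
  *-cong-mod {a = a} {b = b} {c = c} {d = d} (mk≡mod m∣a-b) (mk≡mod m∣c-d) =
    mk≡mod (subst (_ ∣_) (regroup a b c d)
      (∣m∣n⇒∣m+n (∣m⇒∣m*n c m∣a-b) (∣n⇒∣m*n b m∣c-d)))
    where
    regroup : ∀ a b c d → (a - b) * c + b * (c - d) ≡ a * c - b * d
    regroup = solve-∀

  neg-cong-mod : a ≡ b mod m → - a ≡ - b mod m
  neg-cong-mod {a = a} {b = b} (mk≡mod m∣a-b) =
    mk≡mod (subst (_ ∣_) (regroup a b) (∣m⇒∣-m m∣a-b))
    where
    regroup : ∀ a b → - (a - b) ≡ - a - - b
    regroup = solve-∀

  ^-cong-mod : ∀ n → a ≡ b mod m → a ^ n ≡ b ^ n mod m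
  ^-cong-mod zero _ = ≡-mod-refl
  ^-cong-mod (suc n) a≡b = *-cong-mod a≡b (^-cong-mod n a≡b)

  ≡-mod-∣ : d ∣ m → a ≡ b mod m → a ≡ b mod d
  ≡-mod-∣ d∣m (mk≡mod m∣a-b) = mk≡mod (∣-trans d∣m m∣a-b)

  ∣-resp-≡-mod : a ≡ b mod m → m ∣ b → m ∣ a
  ∣-resp-≡-mod a≡b m∣b = ≡0-mod⇒∣ (≡-mod-trans a≡b (∣⇒≡0-mod m∣b))

  ∣⇒+-≡-mod : m ∣ b → a + b ≡ a mod m
  ∣⇒+-≡-mod {a = a} m∣b =
    ≡-mod-trans (+-congˡ-mod a (∣⇒≡0-mod m∣b)) (≡⇒≡-mod (+-identityʳ a))

  prime∣*⇒∣⊎∣ : ∀ {q} a b → Prime q → (+ q) ∣ a * b → ((+ q) ∣ a) ⊎ ((+ q) ∣ b)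
  prime∣*⇒∣⊎∣ a b pq q∣ab
    with euclidsLemma ∣ a ∣ ∣ b ∣ pq (subst (_ ℕD.∣_) (abs-* a b) (∣⇒∣ᵤ q∣ab))
  ... | inj₁ q∣a = inj₁ (∣ᵤ⇒∣ q∣a)
  ... | inj₂ q∣b = inj₂ (∣ᵤ⇒∣ q∣b)

  prime-*-cancelˡ-mod : ∀ {q} → Prime q → ¬ (+ q) ∣ c →
    c * a ≡ c * b mod (+ q) → a ≡ b mod (+ q)
  prime-*-cancelˡ-mod {c = c} {a = a} {b = b} pq q∤c (mk≡mod q∣ca-cb) =
    [ flip contradiction q∤c , mk≡mod ]′
      (prime∣*⇒∣⊎∣ c (a - b) pq (subst (_ ∣_) (factor c a b) q∣ca-cb))
    where
    factor : ∀ c a b → c * a - c * b ≡ c * (a - b)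
    factor = solve-∀

module BinomialCoefficients where

  open import Data.Nat.Base
  open import Data.Nat.Properties using (m≤n⇒m≤1+n; <⇒≤; <⇒≱; ∸-monoʳ-<; _!*_!≢0)
  open import Data.Nat.DivMod using (m/n*n≡m)
  open import Data.Nat.Divisibility
  open import Data.Nat.Primality using (Prime; euclidsLemma; prime⇒nonZero)
  open import Data.Nat.Combinatorics using (_C_; k![n∸k]!∣n!)
  open import Data.Nat.Combinatorics.Specification using (nCk≡n!/k![n-k]!)
  open import Data.Sum using (inj₁; inj₂)
  open import Relation.Nullary using (contradiction)
  open import Relation.Binary.PropositionalEquality
  open NatPrimes using (prime⇒≢1)

  prime∣m!⇒p≤m : ∀ {p} m → Prime p → p ∣ m ! → p ≤ m
  prime∣m!⇒p≤m zero pp p∣1 = contradiction (∣1⇒≡1 p∣1) (prime⇒≢1 pp)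
  prime∣m!⇒p≤m (suc m) pp p∣m! with euclidsLemma (suc m) (m !) pp p∣m!
  ... | inj₁ p∣1+m = ∣⇒≤ p∣1+m
  ... | inj₂ p∣m! = m≤n⇒m≤1+n (prime∣m!⇒p≤m m pp p∣m!)

  n∣n! : ∀ n .{{_ : NonZero n}} → n ∣ n !
  n∣n! (suc n) = m∣m*n (n !)

  n!≡nCk*k![n∸k]! : ∀ {n k} → k ≤ n → n ! ≡ (n C k) * (k ! * (n ∸ k) !)
  n!≡nCk*k![n∸k]! {n} {k} k≤n = sym (begin
    (n C k) * d    ≡⟨ cong (_* d) (nCk≡n!/k![n-k]! k≤n) ⟩
    n ! / d * d    ≡⟨ m/n*n≡m (k![n∸k]!∣n! k≤n) ⟩
    n !            ∎)
    where
    open ≡-Reasoning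
    d : ℕ
    d = k ! * (n ∸ k) !
    instance _ = k !* (n ∸ k) !≢0

  prime∣pCk : ∀ {p k} → Prime p → 0 < k → k < p → p ∣ p C k
  prime∣pCk {p} {k} pp 0<k k<p
    with euclidsLemma (p C k) _ pp
           (subst (p ∣_) (n!≡nCk*k![n∸k]! (<⇒≤ k<p)) (n∣n! p {{prime⇒nonZero pp}}))
  ... | inj₁ p∣pCk = p∣pCk
  ... | inj₂ p∣k![p∸k]! with euclidsLemma (k !) ((p ∸ k) !) pp p∣k![p∸k]!
  ...   | inj₁ p∣k! = contradiction (prime∣m!⇒p≤m k pp p∣k!) (<⇒≱ k<p)
  ...   | inj₂ p∣[p∸k]! =
    contradiction (prime∣m!⇒p≤m (p ∸ k) pp p∣[p∸k]!)
      (<⇒≱ (∸-monoʳ-< {p} {k} {0} 0<k (<⇒≤ k<p)))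

module FermatsLittleTheorem where

  open import Data.Nat.Base as ℕ using (ℕ; zero; suc; z<s; s<s)
  open import Data.Nat.Primality using (Prime; prime⇒nonZero)
  open import Data.Nat.Properties using (n∸n≡0)
  open import Data.Nat.Combinatorics using (_C_; nCn≡1)
  open import Data.Fin.Base using (Fin; zero; suc; toℕ; inject₁; fromℕ)
  open import Data.Fin.Properties using (toℕ-inject₁; toℕ<n; toℕ-fromℕ)
  open import Data.Integer.Base hiding (suc)
  open import Data.Integer.Properties
    using ( +-*-commutativeSemiring; +-0-monoid; pos-+; *-zeroˡ; *-identityˡ; *-identityʳ
          ; ^-zeroˡ)
  open import Data.Integer.DivMod using (_%ℕ_; _/ℕ_; a≡a%ℕn+[a/ℕn]*n)
  open import Data.Integer.Divisibility.Signed
    using (_∣_; divides; ∣ᵤ⇒∣; ∣m∣n⇒∣m+n; ∣m⇒∣m*n)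
  open import Data.Integer.Tactic.RingSolver using (solve-∀)
  open import Algebra.Bundles using (CommutativeSemiring)
  open import Algebra.Properties.Monoid.Sum +-0-monoid using (sum; sum-init-last)
  import Algebra.Properties.CommutativeSemiring.Binomial +-*-commutativeSemiring as Binomial
  open import Algebra.Properties.Semiring.Exp
    (CommutativeSemiring.semiring +-*-commutativeSemiring) using () renaming (_^_ to _^ₛ_)
  open import Algebra.Properties.Monoid.Mult +-0-monoid using (_×_)
  open import Function using (_∘_)
  open import Relation.Nullary using (¬_)
  open import Relation.Binary.PropositionalEquality hiding ([_])
  open Congruence
  open BinomialCoefficients using (prime∣pCk)

  ^ₛ≡^ : ∀ x n → x ^ₛ n ≡ x ^ n
  ^ₛ≡^ x zero = refl
  ^ₛ≡^ x (suc n) = cong (x *_) (^ₛ≡^ x n)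

  ×≡* : ∀ n x → n × x ≡ + n * x
  ×≡* zero x = sym (*-zeroˡ x)
  ×≡* (suc n) x = begin
    x + n × x        ≡⟨ cong (_+_ x) (×≡* n x) ⟩
    x + + n * x      ≡⟨ distrib x (+ n) ⟩
    (1ℤ + + n) * x   ≡⟨ cong (_* x) (sym (pos-+ 1 n)) ⟩
    + suc n * x      ∎
    where
    open ≡-Reasoning
    distrib : ∀ x m → x + m * x ≡ (1ℤ + m) * x
    distrib = solve-∀

  ∣-sum : ∀ {m n} (f : Fin n → ℤ) → (∀ i → m ∣ f i) → m ∣ sum f
  ∣-sum {m} {zero} f _ = divides 0ℤ (sym (*-zeroˡ m))
  ∣-sum {m} {suc n} f m∣f = ∣m∣n⇒∣m+n (m∣f zero) (∣-sum (f ∘ suc) (m∣f ∘ suc))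

  freshman : ∀ {p} → Prime p → ∀ a b → (a + b) ^ p ≡ a ^ p + b ^ p mod (+ p)
  freshman {p@(suc p′)} pp a b = begin
    (a + b) ^ p                    ≡⟨ sym (^ₛ≡^ (a + b) p) ⟩
    (a + b) ^ₛ p                   ≡⟨ Binomial.theorem p a b ⟩
    t zero + sum (t ∘ suc)         ≡⟨ cong (_+_ (t zero)) (sum-init-last (t ∘ suc)) ⟩
    t zero + (sum interior + tₚ)   ≈⟨ +-congˡ-mod (t zero) (+-congʳ-mod tₚ interior≡0) ⟩
    t zero + (0ℤ + tₚ)             ≡⟨ cong₂ (λ u v → u + (0ℤ + v)) t₀≡bᵖ tₚ≡aᵖ ⟩
    b ^ p + (0ℤ + a ^ p)           ≡⟨ regroup (b ^ p) (a ^ p) ⟩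
    a ^ p + b ^ p                  ∎
    where
    open ≡-mod-Reasoning (+ p)
    t : Fin (suc p) → ℤ
    t = Binomial.binomialTerm a b p
    tₚ : ℤ
    tₚ = t (fromℕ p)
    interior : Fin p′ → ℤ
    interior i = t (suc (inject₁ i))
    interior≡0 : sum interior ≡ 0ℤ mod (+ p)
    interior≡0 = ∣⇒≡0-mod (∣-sum interior p∣interior)
      where
      p∣interior : ∀ i → (+ p) ∣ interior i
      p∣interior i = subst ((+ p) ∣_) (sym (×≡* (p C k) _)) (∣m⇒∣m*n _ p∣pCk)
        where
        k : ℕ
        k = suc (toℕ (inject₁ i))
        k<p : k ℕ.< p
        k<p = s<s (subst (ℕ._< p′) (sym (toℕ-inject₁ i)) (toℕ<n i))
        p∣pCk : (+ p) ∣ + (p C k)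
        p∣pCk = ∣ᵤ⇒∣ (prime∣pCk pp z<s k<p)
    t₀≡bᵖ : t zero ≡ b ^ p
    t₀≡bᵖ = trans (×≡* 1 _) (trans (*-identityˡ _) (trans (*-identityˡ _) (^ₛ≡^ b p)))
    tₚ≡aᵖ : tₚ ≡ a ^ p
    tₚ≡aᵖ rewrite toℕ-fromℕ p′ | nCn≡1 p | n∸n≡0 p′ =
      trans (×≡* 1 _) (trans (*-identityˡ _) (trans (*-identityʳ _) (^ₛ≡^ a p)))
    regroup : ∀ x y → x + (0ℤ + y) ≡ y + x
    regroup = solve-∀

  fermat-ℕ : ∀ {p} → Prime p → ∀ n → (+ n) ^ p ≡ + n mod (+ p)
  fermat-ℕ {suc p′} _ zero = ≡⇒≡-mod (*-zeroˡ ((+ 0) ^ p′))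
  fermat-ℕ {p} pp (suc n) = begin
    (+ suc n) ^ p       ≡⟨ cong (_^ p) (pos-+ 1 n) ⟩
    (1ℤ + + n) ^ p      ≈⟨ freshman pp 1ℤ (+ n) ⟩
    1ℤ ^ p + (+ n) ^ p  ≈⟨ +-cong-mod (≡⇒≡-mod (^-zeroˡ p)) (fermat-ℕ pp n) ⟩
    1ℤ + + n            ≡⟨ sym (pos-+ 1 n) ⟩
    + suc n             ∎
    where open ≡-mod-Reasoning (+ p)

  fermat : ∀ {p} → Prime p → ∀ c → c ^ p ≡ c mod (+ p)
  fermat {p} pp c = begin
    c ^ p  ≈⟨ ^-cong-mod p c≡r ⟩
    r ^ p  ≈⟨ fermat-ℕ pp (c %ℕ p) ⟩
    r      ≈⟨ ≡-mod-sym c≡r ⟩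
    c      ∎
    where
    open ≡-mod-Reasoning (+ p)
    instance _ = prime⇒nonZero pp
    r : ℤ
    r = + (c %ℕ p)
    c≡r : c ≡ r mod (+ p)
    c≡r = ≡-mod-trans (≡⇒≡-mod (a≡a%ℕn+[a/ℕn]*n c p)) (∣⇒+-≡-mod (divides (c /ℕ p) refl))

  fermat-unit : ∀ {p c} → Prime p → ¬ (+ p) ∣ c → c ^ (p ℕ.∸ 1) ≡ 1ℤ mod (+ p)
  fermat-unit {suc p′} {c} pp p∤c = prime-*-cancelˡ-mod pp p∤c (begin
    c * c ^ p′  ≈⟨ fermat pp c ⟩
    c           ≡⟨ sym (*-identityʳ c) ⟩
    c * 1ℤ      ∎)
    where open ≡-mod-Reasoning (+ suc p′)

module BarlowRelation where

  open import Data.Nat.Base as ℕ using (ℕ; zero; suc; parity)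
  import Data.Nat.Divisibility as ℕD
  open import Data.Nat.Primality using (Prime)
  open import Data.Parity.Base using (1ℙ)
  open import Data.Integer.Base hiding (suc)
  open import Data.Integer.Properties using (pos-+; neg-involutive; *-zeroʳ; +-inverseʳ; +-identityˡ)
  open import Data.Integer.Coprimality using (Coprime)
  open import Data.Integer.Divisibility.Signed
  open import Data.Integer.Tactic.RingSolver using (solve-∀)
  open import Data.Product using (∃-syntax; _×_; _,_)
  open import Data.Sum using (inj₁; inj₂)
  open import Relation.Nullary using (¬_)
  open import Relation.Binary.PropositionalEquality
  open NatPrimes using (prime⇒≢1; ¬common-prime⇒coprime; prime∣prime⇒≡; prime∣^⇒prime∣)
  open IntegerPowers using (neg-^-odd; abs-^; coprime-*≡^⇒^ℤ)
  open Congruence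

  Φ : ℕ → ℤ → ℤ → ℤ
  Φ zero a b = 0ℤ
  Φ (suc n) a b = a ^ n + b * Φ n a b

  Φ-factor : ∀ n a b → (a - b) * Φ n a b ≡ a ^ n - b ^ n
  Φ-factor zero a b = trans (*-zeroʳ (a - b)) (sym (+-inverseʳ 1ℤ))
  Φ-factor (suc n) a b = begin
    (a - b) * (a ^ n + b * Φ n a b)            ≡⟨ expand a b (a ^ n) (Φ n a b) ⟩
    (a - b) * a ^ n + b * ((a - b) * Φ n a b)  ≡⟨ cong (λ t → (a - b) * a ^ n + b * t)
                                                       (Φ-factor n a b) ⟩
    (a - b) * a ^ n + b * (a ^ n - b ^ n)      ≡⟨ collect a b (a ^ n) (b ^ n) ⟩
    a * a ^ n - b * b ^ n                      ∎
    where
    open ≡-Reasoning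
    expand : ∀ a b A F → (a - b) * (A + b * F) ≡ (a - b) * A + b * ((a - b) * F)
    expand = solve-∀
    collect : ∀ a b A B → (a - b) * A + b * (A - B) ≡ a * A - b * B
    collect = solve-∀

  Φ-congʳ-mod : ∀ n {a b b′ m} → b ≡ b′ mod m → Φ n a b ≡ Φ n a b′ mod m
  Φ-congʳ-mod zero _ = ≡-mod-refl
  Φ-congʳ-mod (suc n) {a} b≡b′ =
    +-congˡ-mod (a ^ n) (*-cong-mod b≡b′ (Φ-congʳ-mod n b≡b′))

  Φ-diagonal : ∀ n a → Φ (suc n) a a ≡ + suc n * a ^ n
  Φ-diagonal zero a = base a
    where
    base : ∀ a → 1ℤ + a * 0ℤ ≡ 1ℤ * 1ℤ
    base = solve-∀
  Φ-diagonal (suc n) a = begin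
    a * a ^ n + a * Φ (suc n) a a       ≡⟨ cong (λ t → a * a ^ n + a * t) (Φ-diagonal n a) ⟩
    a * a ^ n + a * (+ suc n * a ^ n)   ≡⟨ collect a (a ^ n) (+ suc n) ⟩
    (1ℤ + + suc n) * (a * a ^ n)        ≡⟨ cong (_* (a * a ^ n)) (sym (pos-+ 1 (suc n))) ⟩
    + suc (suc n) * (a * a ^ n)         ∎
    where
    open ≡-Reasoning
    collect : ∀ a A k → a * A + a * (k * A) ≡ (1ℤ + k) * (a * A)
    collect = solve-∀

  Φ≡-mod : ∀ n a b → Φ (suc n) a b ≡ + suc n * a ^ n mod (a - b)
  Φ≡-mod n a b = ≡-mod-trans (Φ-congʳ-mod (suc n) b≡a) (≡⇒≡-mod (Φ-diagonal n a))
    where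
    b≡a : b ≡ a mod (a - b)
    b≡a = mk≡mod (divides (- 1ℤ) (flip a b))
      where
      flip : ∀ a b → b - a ≡ - 1ℤ * (a - b)
      flip = solve-∀

  barlow : ∀ {p} → Prime p → parity p ≡ 1ℙ → ∀ {a y w} → Coprime a y → (+ p) ∣ y →
           a ^ p + y ^ p + w ^ p ≡ 0ℤ → ∃[ c ] a + y ≡ c ^ p
  barlow {p@(suc p′)} pp odd {a} {y} {w} a⊥y p∣y sum≡0 =
    coprime-*≡^⇒^ℤ p odd (- w) [a+y]⊥F [a+y]F≡[-w]ᵖ
    where
    F : ℤ
    F = Φ p a (- y)

    a-[-y]≡a+y : a - - y ≡ a + y
    a-[-y]≡a+y = cong (_+_ a) (neg-involutive y)

    [a+y]F≡[-w]ᵖ : (a + y) * F ≡ (- w) ^ p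
    [a+y]F≡[-w]ᵖ = begin
      (a + y) * F                        ≡⟨ cong (_* F) (sym a-[-y]≡a+y) ⟩
      (a - - y) * F                      ≡⟨ Φ-factor p a (- y) ⟩
      a ^ p - (- y) ^ p                  ≡⟨ cong (λ t → a ^ p - t) (neg-^-odd y p odd) ⟩
      a ^ p - - (y ^ p)                  ≡⟨ regroup (a ^ p) (y ^ p) (w ^ p) ⟩
      (a ^ p + y ^ p + w ^ p) - w ^ p    ≡⟨ cong (_- w ^ p) sum≡0 ⟩
      0ℤ - w ^ p                         ≡⟨ +-identityˡ (- w ^ p) ⟩
      - w ^ p                            ≡⟨ sym (neg-^-odd w p odd) ⟩
      (- w) ^ p                          ∎
      where
      open ≡-Reasoning
      regroup : ∀ A Y W → A - - Y ≡ (A + Y + W) - W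
      regroup = solve-∀

    [a+y]⊥F : Coprime (a + y) F
    [a+y]⊥F = ¬common-prime⇒coprime λ {r} pr r∣a+y r∣F →
      prime∤a+y∨F pr (∣ᵤ⇒∣ {+ r} {a + y} r∣a+y) (∣ᵤ⇒∣ {+ r} {F} r∣F)
      where
      prime∣a+y∧p*aᵖ′⇒∣a : ∀ {r} → Prime r →
        (+ r) ∣ a + y → (+ r) ∣ + p * a ^ p′ → (+ r) ∣ a
      prime∣a+y∧p*aᵖ′⇒∣a {r} pr r∣a+y r∣pa^p′
        with prime∣*⇒∣⊎∣ (+ p) (a ^ p′) pr r∣pa^p′
      ... | inj₁ r∣p with refl ← prime∣prime⇒≡ pr pp (∣⇒∣ᵤ r∣p) = ∣m+n∣n⇒∣m r∣a+y p∣y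
      ... | inj₂ r∣a^p′ =
        ∣ᵤ⇒∣ (prime∣^⇒prime∣ p′ pr (subst (r ℕD.∣_) (abs-^ a p′) (∣⇒∣ᵤ r∣a^p′)))

      prime∤a+y∨F : ∀ {r} → Prime r → (+ r) ∣ a + y → ¬ (+ r) ∣ F
      prime∤a+y∨F {r} pr r∣a+y r∣F = prime⇒≢1 pr (a⊥y (∣⇒∣ᵤ r∣a , ∣⇒∣ᵤ r∣y))
        where
        F≡pa^p′ : F ≡ + p * a ^ p′ mod (+ r)
        F≡pa^p′ = ≡-mod-∣ (subst (+ r ∣_) (sym a-[-y]≡a+y) r∣a+y) (Φ≡-mod p′ a (- y))
        r∣a : (+ r) ∣ a
        r∣a = prime∣a+y∧p*aᵖ′⇒∣a pr r∣a+y (∣-resp-≡-mod (≡-mod-sym F≡pa^p′) r∣F)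
        r∣y : (+ r) ∣ y
        r∣y = ∣m+n∣m⇒∣n r∣a+y r∣a

  barlow-mod : ∀ {p q} → Prime p → parity p ≡ 1ℙ → Prime q → ∀ {a y w} → Coprime a y →
    (+ p) ∣ y → (+ q) ∣ y → a ^ p + y ^ p + w ^ p ≡ 0ℤ →
    ∃[ c ] c ^ p ≡ a mod (+ q) × ¬ (+ q) ∣ c
  barlow-mod {p@(suc p′)} {q} pp odd pq {a} {y} {w} a⊥y p∣y q∣y sum≡0 =
    let c , a+y≡cᵖ = barlow pp odd {a} {y} {w} a⊥y p∣y sum≡0
    in c , cᵖ≡a c a+y≡cᵖ , q∤c c a+y≡cᵖ
    where
    cᵖ≡a : ∀ c → a + y ≡ c ^ p → c ^ p ≡ a mod (+ q)
    cᵖ≡a c a+y≡cᵖ = ≡-mod-trans (≡⇒≡-mod (sym a+y≡cᵖ)) (∣⇒+-≡-mod q∣y)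
    q∤c : ∀ c → a + y ≡ c ^ p → ¬ (+ q) ∣ c
    q∤c c a+y≡cᵖ q∣c = prime⇒≢1 pq (a⊥y (∣⇒∣ᵤ q∣a , ∣⇒∣ᵤ q∣y))
      where
      q∣a : (+ q) ∣ a
      q∣a = ∣-resp-≡-mod (≡-mod-sym (cᵖ≡a c a+y≡cᵖ)) (∣m⇒∣m*n (c ^ p′) q∣c)

module CommonExponents where

  open import Data.Nat.Base as ℕ using (ℕ)
  import Data.Nat.Properties as ℕₚ
  import Data.Nat.Divisibility as ℕD
  open import Data.Nat.GCD using (gcd; gcd-GCD; gcd[m,n]∣m; gcd[m,n]∣n; module Bézout)
  open import Data.Nat.Primality using (Prime)
  open import Data.Sum using (inj₁; inj₂)
  open import Data.Integer.Base
  open import Data.Integer.Properties using (^-*-assoc; ^-distribˡ-+-*; *-comm)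
  open import Data.Integer.Divisibility.Signed using (_∣_; ∣ᵤ⇒∣; ∣⇒∣ᵤ)
  open import Relation.Nullary using (¬_; contradiction)
  open import Relation.Binary.PropositionalEquality
  open NatPrimes using (prime∣^⇒prime∣; ∣p*p⇒∣p⊎≡p*p)
  open IntegerPowers using (abs-^)
  open Congruence
  open FermatsLittleTheorem using (fermat-unit)

  private variable c u : ℤ

  ^-*-cong-mod : ∀ {m} j k → c ^ k ≡ u ^ k mod m → c ^ (j ℕ.* k) ≡ u ^ (j ℕ.* k) mod m
  ^-*-cong-mod {c} {u} {m} j k cᵏ≡uᵏ = begin
    c ^ (j ℕ.* k)  ≡⟨ pow-swap c ⟩
    (c ^ k) ^ j    ≈⟨ ^-cong-mod j cᵏ≡uᵏ ⟩
    (u ^ k) ^ j    ≡⟨ sym (pow-swap u) ⟩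
    u ^ (j ℕ.* k)  ∎
    where
    open ≡-mod-Reasoning m
    pow-swap : ∀ i → i ^ (j ℕ.* k) ≡ (i ^ k) ^ j
    pow-swap i = trans (cong (i ^_) (ℕₚ.*-comm j k)) (sym (^-*-assoc i k j))

  prime∤⇒prime∤^ : ∀ {q} k → Prime q → ¬ (+ q) ∣ c → ¬ (+ q) ∣ c ^ k
  prime∤⇒prime∤^ {c} {q} k pq q∤c q∣cᵏ =
    q∤c (∣ᵤ⇒∣ (prime∣^⇒prime∣ k pq (subst (q ℕD.∣_) (abs-^ c k) (∣⇒∣ᵤ q∣cᵏ))))

  ^-cancel-mod : ∀ {q} d k → Prime q → ¬ (+ q) ∣ c →
    c ^ k ≡ u ^ k mod (+ q) → c ^ (d ℕ.+ k) ≡ u ^ (d ℕ.+ k) mod (+ q) →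
    c ^ d ≡ u ^ d mod (+ q)
  ^-cancel-mod {c} {u} {q} d k pq q∤c cᵏ≡uᵏ cᵈ⁺ᵏ≡uᵈ⁺ᵏ =
    prime-*-cancelˡ-mod pq (prime∤⇒prime∤^ k pq q∤c) (begin
      c ^ k * c ^ d    ≡⟨ sym (split c) ⟩
      c ^ (d ℕ.+ k)    ≈⟨ cᵈ⁺ᵏ≡uᵈ⁺ᵏ ⟩
      u ^ (d ℕ.+ k)    ≡⟨ split u ⟩
      u ^ k * u ^ d    ≈⟨ *-cong-mod (≡-mod-sym cᵏ≡uᵏ) (≡-mod-refl {a = u ^ d}) ⟩
      c ^ k * u ^ d    ∎)
    where
    open ≡-mod-Reasoning (+ q)
    split : ∀ i → i ^ (d ℕ.+ k) ≡ i ^ k * i ^ d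
    split i = trans (^-distribˡ-+-* i d k) (*-comm (i ^ d) (i ^ k))

  ^-gcd-cong-mod : ∀ {q} m n → Prime q → ¬ (+ q) ∣ c →
    c ^ m ≡ u ^ m mod (+ q) → c ^ n ≡ u ^ n mod (+ q) → c ^ gcd m n ≡ u ^ gcd m n mod (+ q)
  ^-gcd-cong-mod {c} {u} {q} m n pq q∤c cᵐ≡uᵐ cⁿ≡uⁿ with Bézout.identity (gcd-GCD m n)
  ... | Bézout.+- x y d+yn≡xm =
    ^-cancel-mod (gcd m n) (y ℕ.* n) pq q∤c (^-*-cong-mod y n cⁿ≡uⁿ)
      (subst (λ e → c ^ e ≡ u ^ e mod (+ q)) (sym d+yn≡xm) (^-*-cong-mod x m cᵐ≡uᵐ))
  ... | Bézout.-+ x y d+xm≡yn =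
    ^-cancel-mod (gcd m n) (x ℕ.* m) pq q∤c (^-*-cong-mod x m cᵐ≡uᵐ)
      (subst (λ e → c ^ e ≡ u ^ e mod (+ q)) (sym d+xm≡yn) (^-*-cong-mod y n cⁿ≡uⁿ))

  p*p∣q∸1 : ∀ {p q} → Prime p → Prime q → ¬ (+ q) ∣ c → ¬ (+ q) ∣ u →
    c ^ (p ℕ.* p) ≡ u ^ (p ℕ.* p) mod (+ q) → ¬ c ^ p ≡ u ^ p mod (+ q) →
    p ℕ.* p ℕD.∣ q ℕ.∸ 1
  p*p∣q∸1 {c} {u} {p} {q} pp pq q∤c q∤u cᵖᵖ≡uᵖᵖ cᵖ≢uᵖ
    with ∣p*p⇒∣p⊎≡p*p pp (gcd[m,n]∣m (p ℕ.* p) (q ℕ.∸ 1))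
  ... | inj₂ d≡p*p = subst (ℕD._∣ q ℕ.∸ 1) d≡p*p (gcd[m,n]∣n (p ℕ.* p) (q ℕ.∸ 1))
  ... | inj₁ (ℕD.divides j p≡jd) =
    contradiction (subst (λ e → c ^ e ≡ u ^ e mod (+ q)) (sym p≡jd) (^-*-cong-mod j d cᵈ≡uᵈ))
      cᵖ≢uᵖ
    where
    d : ℕ
    d = gcd (p ℕ.* p) (q ℕ.∸ 1)
    cᵈ≡uᵈ : c ^ d ≡ u ^ d mod (+ q)
    cᵈ≡uᵈ = ^-gcd-cong-mod (p ℕ.* p) (q ℕ.∸ 1) pq q∤c cᵖᵖ≡uᵖᵖ
      (≡-mod-trans (fermat-unit pq q∤c) (≡-mod-sym (fermat-unit pq q∤u)))


module PowerResidues where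

  open import Data.Nat.Base as ℕ using (suc; parity)
  import Data.Nat.Divisibility as ℕD
  open import Data.Nat.Primality using (Prime)
  open import Data.Parity.Base using (1ℙ)
  open import Data.Integer.Base hiding (suc)
  open import Data.Integer.Properties using (^-*-assoc; neg-involutive; +-identityˡ)
  open import Data.Integer.Divisibility.Signed using (_∣_; ∣m⇒∣-m; ∣m⇒∣m*n)
  open import Data.Integer.Tactic.RingSolver using (solve-∀)
  open import Relation.Nullary using (¬_)
  open import Relation.Binary.PropositionalEquality
  open IntegerPowers using (neg-^-odd)
  open Congruence
  open CommonExponents using (p*p∣q∸1)

  p*p∣q∸1-of-roots : ∀ {p q x y z c e} → Prime p → parity p ≡ 1ℙ → Prime q →
    x ^ p + y ^ p + z ^ p ≡ 0ℤ → (+ q) ∣ y → ¬ (+ q) ∣ x + z →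
    c ^ p ≡ x mod (+ q) → e ^ p ≡ z mod (+ q) → ¬ (+ q) ∣ c → ¬ (+ q) ∣ e →
    p ℕ.* p ℕD.∣ q ℕ.∸ 1
  p*p∣q∸1-of-roots {p@(suc p′)} {q} {x} {y} {z} {c} {e}
                   pp odd pq sum≡0 q∣y q∤x+z cᵖ≡x eᵖ≡z q∤c q∤e =
    p*p∣q∸1 pp pq q∤c q∤-e cᵖᵖ≡[-e]ᵖᵖ cᵖ≢[-e]ᵖ
    where
    open ≡-mod-Reasoning (+ q)

    [-e]ᵖ≡-z : (- e) ^ p ≡ - z mod (+ q)
    [-e]ᵖ≡-z = ≡-mod-trans (≡⇒≡-mod (neg-^-odd e p odd)) (neg-cong-mod eᵖ≡z)

    q∤-e : ¬ (+ q) ∣ - e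
    q∤-e q∣-e = q∤e (subst ((+ q) ∣_) (neg-involutive e) (∣m⇒∣-m q∣-e))

    xᵖ≡-zᵖ : x ^ p ≡ - z ^ p mod (+ q)
    xᵖ≡-zᵖ = begin
      x ^ p                              ≈⟨ ≡-mod-sym (∣⇒+-≡-mod (∣m⇒∣m*n (y ^ p′) q∣y)) ⟩
      x ^ p + y ^ p                      ≡⟨ isolate (x ^ p) (y ^ p) (z ^ p) ⟩
      (x ^ p + y ^ p + z ^ p) - z ^ p    ≡⟨ cong (_- z ^ p) sum≡0 ⟩
      0ℤ - z ^ p                         ≡⟨ +-identityˡ (- z ^ p) ⟩
      - z ^ p                            ∎
      where
      isolate : ∀ X Y Z → X + Y ≡ (X + Y + Z) - Z
      isolate = solve-∀

    cᵖᵖ≡[-e]ᵖᵖ : c ^ (p ℕ.* p) ≡ (- e) ^ (p ℕ.* p) mod (+ q)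
    cᵖᵖ≡[-e]ᵖᵖ = begin
      c ^ (p ℕ.* p)       ≡⟨ sym (^-*-assoc c p p) ⟩
      (c ^ p) ^ p         ≈⟨ ^-cong-mod p cᵖ≡x ⟩
      x ^ p               ≈⟨ xᵖ≡-zᵖ ⟩
      - z ^ p             ≡⟨ sym (neg-^-odd z p odd) ⟩
      (- z) ^ p           ≈⟨ ^-cong-mod p (≡-mod-sym [-e]ᵖ≡-z) ⟩
      ((- e) ^ p) ^ p     ≡⟨ ^-*-assoc (- e) p p ⟩
      (- e) ^ (p ℕ.* p)   ∎

    cᵖ≢[-e]ᵖ : ¬ c ^ p ≡ (- e) ^ p mod (+ q)
    cᵖ≢[-e]ᵖ cᵖ≡[-e]ᵖ =
      q∤x+z (subst ((+ q) ∣_) (cong (_+_ x) (neg-involutive z)) (∣-difference x≡-z))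
      where
      x≡-z : x ≡ - z mod (+ q)
      x≡-z = ≡-mod-trans (≡-mod-sym cᵖ≡x) (≡-mod-trans cᵖ≡[-e]ᵖ [-e]ᵖ≡-z)

open import Defs
open import Data.Nat as ℕ using (ℕ)
open import Data.Nat.Divisibility as ℕD using ()
open import Data.Nat.Primality using (Prime)
open import Data.Integer using (ℤ; +_; _+_; _^_; 0ℤ)
open import Data.Integer.Divisibility using (_∣_)
open import Data.Integer.Coprimality using (Coprime)
open import Relation.Binary.PropositionalEquality using (_≡_; _≢_)
open import Relation.Nullary using (¬_)

open import Data.Nat.Properties using (>⇒≢; <-trans; n<1+n)
open import Data.Nat.Base using (parity)
import Data.Integer.Coprimality as Coprimality
import Data.Integer.Divisibility.Signed as Signed
open Signed using (∣ᵤ⇒∣; ∣⇒∣ᵤ)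
open import Data.Parity.Base using (1ℙ)
open import Data.Integer.Tactic.RingSolver using (solve-∀)
open import Data.Product using (_,_)
open import Function using (_∘_)
open import Relation.Binary.PropositionalEquality using (trans)
open NatPrimes using (prime≢2⇒parity≡1)
open BarlowRelation using (barlow-mod)
open PowerResidues using (p*p∣q∸1-of-roots)

mainTheorem1 : (p : ℕ) → Prime p → 3 ℕ.< p →
    (x y z : ℤ) → x ≢ 0ℤ → y ≢ 0ℤ → z ≢ 0ℤ →
    Coprime x y → Coprime y z → Coprime x z →
    (+ p) ∣ y → (x ^ p) + (y ^ p) + (z ^ p) ≡ 0ℤ →
    (q : ℕ) → Prime q → q ≢ p → (+ q) ∣ y → ¬ ((+ q) ∣ (x + z)) →
    (p ℕ.* p) ℕD.∣ (q ℕ.∸ 1)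
mainTheorem1 p pp 3<p x y z _ _ _ x⊥y y⊥z _ p∣y xᵖ+yᵖ+zᵖ≡0 q pq _ q∣y q∤x+z =
  let c , cᵖ≡x , q∤c = barlow-mod pp odd pq {x} {y} {z} x⊥y p∣yˢ q∣yˢ xᵖ+yᵖ+zᵖ≡0
      e , eᵖ≡z , q∤e =
        barlow-mod pp odd pq {z} {y} {x} (Coprimality.sym {y} {z} y⊥z) p∣yˢ q∣yˢ zᵖ+yᵖ+xᵖ≡0
  in p*p∣q∸1-of-roots pp odd pq xᵖ+yᵖ+zᵖ≡0 q∣yˢ (q∤x+z ∘ ∣⇒∣ᵤ) cᵖ≡x eᵖ≡z q∤c q∤e
  where
  odd : parity p ≡ 1ℙ
  odd = prime≢2⇒parity≡1 pp (>⇒≢ (<-trans (n<1+n 2) 3<p))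
  p∣yˢ : (+ p) Signed.∣ y
  p∣yˢ = ∣ᵤ⇒∣ p∣y
  q∣yˢ : (+ q) Signed.∣ y
  q∣yˢ = ∣ᵤ⇒∣ q∣y
  zᵖ+yᵖ+xᵖ≡0 : z ^ p + y ^ p + x ^ p ≡ 0ℤ
  zᵖ+yᵖ+xᵖ≡0 = trans (reverse (z ^ p) (y ^ p) (x ^ p)) xᵖ+yᵖ+zᵖ≡0
    where
    reverse : ∀ Z Y X → Z + Y + X ≡ X + Y + Z
    reverse = solve-∀
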